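{- Let $\underline c=(c_1,\ldots,c_n)$ with $c_k\in\{0,\pm1,\ldots,\pm r\}$, and let $\mathcal B(\underline c)$ be the set of words $w_1\cdots w_n$ where $w_k\subseteq\{1,\ldots,r\}$ with $|w_k|=c_k$ if $c_k\ge0$, and $w_k\subseteq\{ -1,\ldots,-r\}$ with $|w_k|=-c_k$ if $c_k<0$. Then the set of highest weight elements of $\mathcal B(\underline c)$ (words with $e_i(w)=0$ for all $1\le i\le r-1$) is exactly the set of lattice words of $r$-row non-skew fluctuating tableaux of type $\underline c$.
   Context: Let $\mathcal A_r$ be the set of subsets $S\subseteq\{\pm1,\ldots,\pm r\}$ with all elements of the same sign (including $\emptyset$); $\mathbf e_S=\sum_{s\in S}\mathbf e_s$ if $S$ is positive and $\mathbf e_S=-\sum_{s\in S}\mathbf e_{ -s}$ if negative. An $r$-row non-skew fluctuating tableau of length $n$ is a sequence $0=\lambda^0,\ldots,\lambda^n$ of weakly decreasing vectors in $\mathbb Z^r$ with $\lambda^k=\lambda^{k-1}+\mathbf e_{S_k}$, $S_k\in\mathcal A_r$; its type has $c_k=\pm|S_k|$ with the sign of $S_k$ (and $c_k=0$ if $S_k=\emptyset$), and its lattice word is $S_1\cdots S_n$. Crystal operators $e_i$ ($1\le i\le r-1$) on such words (bracketing rule): write "[" under each letter containing $i$ but not $i+1$, or $-(i+1)$ but not $-i$; write "]" under each letter containing $i+1$ but not $i$, or $-i$ but not $-(i+1)$; match brackets from the inside out. $e_i$ acts on the letter with the rightmost unmatched "]" by replacing $i+1$ with $i$, or $-i$ with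 $-(i+1)$, and $e_i(w)=0$ if there is no unmatched "]". -}

module Defs where

open import Data.Nat as ℕ using (ℕ; zero; suc)
open import Data.Integer as ℤ using (ℤ; +_; -[1+_]; _+_; _-_)
open import Data.Bool using (Bool; true; false; if_then_else_; _∧_; not; _∨_)
open import Data.Fin as Fin using (Fin; toℕ; inject₁)
open import Data.Fin.Subset as Sub using (Subset; ∣_∣)
open import Data.Vec as Vec using (Vec; lookup; _[_]≔_)
open import Data.List as List using (List; []; _∷_; length)
open import Data.Maybe using (Maybe; just; nothing)
open import Data.Product using (_×_; _,_)
open import Data.Sum using (_⊎_)
open import Relation.Binary.PropositionalEquality using (_≡_)

-- A letter S ⊆ {±1,…,±r} is represented by the pair (P , N) where
-- P = { s > 0 : s ∈ S }  and  N = { s > 0 : -s ∈ S }  (rows 1..r are Fin r, 0-based).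
Letter : ℕ → Set
Letter r = Subset r × Subset r

Word : ℕ → Set
Word r = List (Letter r)

InA : ∀ {r} → Letter r → Set
InA (P , N) = P ≡ Sub.⊥ ⊎ N ≡ Sub.⊥

indicator : Bool → ℤ
indicator true  = + 1
indicator false = + 0

eS : ∀ {r} → Letter r → Fin r → ℤ
eS (P , N) j = indicator (lookup P j) - indicator (lookup N j)

letterType : ∀ {r} → Letter r → ℤ
letterType (P , N) = (+ ∣ P ∣) - (+ ∣ N ∣)

WeaklyDecreasing : ∀ {r} → (Fin r → ℤ) → Set
WeaklyDecreasing {r} v = ∀ (a b : Fin r) → a Fin.≤ b → v b ℤ.≤ v a

record FluctuatingTableau (r n : ℕ) : Set where
  field
    shape   : Fin (suc n) → Fin r → ℤ
    letter  : Fin n → Letter r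
    start   : ∀ j → shape Fin.zero j ≡ + 0
    letterA : ∀ k → InA (letter k)
    step    : ∀ k j → shape (Fin.suc k) j ≡ shape (inject₁ k) j + eS (letter k) j
    decr    : ∀ k → WeaklyDecreasing (shape k)

open FluctuatingTableau public

tableauType : ∀ {r n} → FluctuatingTableau r n → List ℤ
tableauType T = List.tabulate (λ k → letterType (letter T k))

latticeWord : ∀ {r n} → FluctuatingTableau r n → Word r
latticeWord T = List.tabulate (letter T)

LetterOfType : ∀ {r} → ℤ → Letter r → Set
LetterOfType (+ m)     (P , N) = N ≡ Sub.⊥ × ∣ P ∣ ≡ m
LetterOfType -[1+ m ]  (P , N) = P ≡ Sub.⊥ × ∣ N ∣ ≡ suc m

InB : ∀ {r} → List ℤ → Word r → Set
InB []       []       = Data.Unit.⊤ where import Data.Unit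
InB []       (_ ∷ _)  = Data.Empty.⊥ where import Data.Empty
InB (_ ∷ _)  []       = Data.Empty.⊥ where import Data.Empty
InB (c ∷ cs) (w ∷ ws) = LetterOfType c w × InB cs ws

-- bracketing rule for the crystal operator e_i, rows a = i, b = i+1 (0-based Fin)
data Bracket : Set where
  opn cls none : Bracket

bracket : ∀ {r} → Fin r → Fin r → Letter r → Bracket
bracket a b (P , N) =
  if (lookup P a ∧ not (lookup P b)) ∨ (lookup N b ∧ not (lookup N a)) then opn
  else if (lookup P b ∧ not (lookup P a)) ∨ (lookup N a ∧ not (lookup N b)) then cls
  else none

-- scan left to right: position, number of currently unmatched "[", last unmatched "]" so far
rightmostUnmatched : ℕ → ℕ → Maybe ℕ → List Bracket → Maybe ℕ
rightmostUnmatched pos o last []           = last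
rightmostUnmatched pos o last (opn ∷ bs)   = rightmostUnmatched (suc pos) (suc o) last bs
rightmostUnmatched pos zero last (cls ∷ bs)    = rightmostUnmatched (suc pos) zero (just pos) bs
rightmostUnmatched pos (suc o) last (cls ∷ bs) = rightmostUnmatched (suc pos) o last bs
rightmostUnmatched pos o last (none ∷ bs)  = rightmostUnmatched (suc pos) o last bs

-- replace i+1 by i, or -i by -(i+1)
actLetter : ∀ {r} → Fin r → Fin r → Letter r → Letter r
actLetter a b (P , N) =
  if lookup P b then ((P [ b ]≔ false) [ a ]≔ true , N)
  else (P , (N [ a ]≔ false) [ b ]≔ true)

modifyAt : ∀ {A : Set} → ℕ → (A → A) → List A → List A
modifyAt _       f []       = []
modifyAt zero    f (x ∷ xs) = f x ∷ xs
modifyAt (suc k) f (x ∷ xs) = x ∷ modifyAt k f xs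

-- e_i(w), with `nothing` playing the role of 0
crystalE : ∀ {r} → Fin r → Fin r → Word r → Maybe (Word r)
crystalE a b w with rightmostUnmatched 0 0 nothing (List.map (bracket a b) w)
... | nothing = nothing
... | just k  = just (modifyAt k (actLetter a b) w)

-- highest weight: e_i(w) = 0 for all 1 ≤ i ≤ r-1 (i = toℕ a + 1, i+1 = toℕ b + 1)
HighestWeight : ∀ {r} → Word r → Set
HighestWeight {r} w = ∀ (a b : Fin r) → toℕ b ≡ suc (toℕ a) → crystalE a b w ≡ nothing

-- A letter of 𝒜_r changes λ_i − λ_{i+1} by +1 if it carries a "[" for e_i, by −1 if it
-- carries a "]", and by 0 otherwise.  Hence, reading a word from λ = 0, as long as every "]"
-- so far is matched the difference λ_i − λ_{i+1} is the number of unmatched "[", and the first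
-- unmatched "]" makes it negative.  So e_i w = 0 for all i exactly when every partial sum
-- λ^k stays weakly decreasing, i.e. when w is the lattice word of a fluctuating tableau,
-- whose type is then read off letter by letter.
module Submission where

open import Defs
open import Data.Nat using (ℕ; _≤_)
open import Data.Integer using (ℤ; ∣_∣)
open import Data.List using (List; length)
open import Data.List.Relation.Unary.All using (All)
open import Data.Product using (_×_; ∃)
open import Function.Bundles using (_⇔_)
open import Relation.Binary.PropositionalEquality using (_≡_)

open import Data.Nat as ℕ using (zero; suc)
import Data.Nat.Properties as ℕ
open import Data.Integer as ℤ using (+_; _+_)
import Data.Integer.Properties as ℤ
open import Data.Integer.Tactic.RingSolver using (solve-∀)
open import Data.Bool using (true; false)
open import Data.Fin as Fin using (Fin; toℕ)
import Data.Fin.Properties as Fin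
open import Data.Fin.Subset as Sub using (Subset)
import Data.Fin.Subset.Properties as SubP
open import Data.Vec using ([]; _∷_; lookup)
open import Data.Vec.Properties using (lookup-replicate)
open import Data.List as List using ([]; _∷_)
open import Data.List.Relation.Unary.All using ([]; _∷_)
open import Data.Maybe using (just; nothing)
open import Data.Product using (Σ; _,_; proj₁; proj₂)
open import Data.Sum using (inj₁; inj₂)
open import Data.Unit using (⊤; tt)
open import Data.Empty using (⊥)
open import Function.Base using (_∘_; const)
open import Function.Bundles using (mk⇔; Equivalence)
import Function.Construct.Composition as Fn
open import Relation.Binary.PropositionalEquality
  using (_≢_; refl; sym; trans; cong; cong₂; subst; subst₂)

private variable
  r : ℕ

Shape : ℕ → Set
Shape r = Fin r → ℤ

_⊕_ : Shape r → Letter r → Shape r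
(v ⊕ x) j = v j + eS x j

AlongWord : (Shape r → Set) → Shape r → Word r → Set
AlongWord P v []       = P v
AlongWord P v (x ∷ xs) = P v × AlongWord P (v ⊕ x) xs

AlongWord-map : {P Q : Shape r → Set} → (∀ {u} → P u → Q u) →
  ∀ {v} w → AlongWord P v w → AlongWord Q v w
AlongWord-map f []      p        = f p
AlongWord-map f (x ∷ w) (p , ps) = f p , AlongWord-map f w ps

AlongWord-head : {P : Shape r → Set} {v : Shape r} (w : Word r) → AlongWord P v w → P v
AlongWord-head []      p       = p
AlongWord-head (x ∷ w) (p , _) = p

AlongWord-∀ : {I : Set} {P : I → Shape r → Set} {v : Shape r} (w : Word r) →
  (∀ i → AlongWord (P i) v w) → AlongWord (λ u → ∀ i → P i u) v w
AlongWord-∀ []      ps = ps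
AlongWord-∀ (x ∷ w) ps = (λ i → proj₁ (ps i)) , AlongWord-∀ w (λ i → proj₂ (ps i))

Adjacent : Fin r → Fin r → Set
Adjacent a b = toℕ b ≡ suc (toℕ a)

AdjacentRows : ℕ → Set
AdjacentRows r = Σ (Fin r × Fin r) λ (a , b) → Adjacent a b

RowsOrdered : Fin r → Fin r → Shape r → Set
RowsOrdered a b v = v b ℤ.≤ v a

weaklyDecreasing⇒adjacent : {v : Shape r} → WeaklyDecreasing v →
  ((((a , b) , _) : AdjacentRows r) → RowsOrdered a b v)
weaklyDecreasing⇒adjacent wd ((a , b) , a~b) =
  wd a b (subst (toℕ a ℕ.≤_) (sym a~b) (ℕ.n≤1+n (toℕ a)))

adjacent⇒weaklyDecreasing : {v : Shape r} →
  ((((a , b) , _) : AdjacentRows r) → RowsOrdered a b v) → WeaklyDecreasing v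
adjacent⇒weaklyDecreasing {r} {v} ordered a b a≤b =
  chain (toℕ b ℕ.∸ toℕ a) b (sym (ℕ.m∸n+n≡m a≤b))
  where
  chain : ∀ d b → toℕ b ≡ d ℕ.+ toℕ a → v b ℤ.≤ v a
  chain zero    b b≡a rewrite Fin.toℕ-injective b≡a = ℤ.≤-refl
  chain (suc d) b b≡1+d+a =
    ℤ.≤-trans (ordered ((b′ , b) , b′~b)) (chain d b′ (Fin.toℕ-fromℕ< d+a<r))
    where
    d+a<r : d ℕ.+ toℕ a ℕ.< r
    d+a<r = ℕ.<-trans (subst (d ℕ.+ toℕ a ℕ.<_) (sym b≡1+d+a) (ℕ.n<1+n _)) (Fin.toℕ<n b)
    b′ : Fin r
    b′ = Fin.fromℕ< d+a<r
    b′~b : Adjacent b′ b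
    b′~b = trans b≡1+d+a (cong suc (sym (Fin.toℕ-fromℕ< d+a<r)))

data BracketEffect (da db : ℤ) : Bracket → Set where
  opens   : da ≡ db + + 1 → BracketEffect da db opn
  closes  : db ≡ da + + 1 → BracketEffect da db cls
  neutral : da ≡ db       → BracketEffect da db none

bracket-effect : (x : Letter r) → InA x → ∀ a b → BracketEffect (eS x a) (eS x b) (bracket a b x)
bracket-effect (P , _) (inj₂ refl) a b
  rewrite lookup-replicate a false | lookup-replicate b false
  with lookup P a | lookup P b
... | true  | true  = neutral refl
... | true  | false = opens refl
... | false | true  = closes refl
... | false | false = neutral refl
bracket-effect (_ , N) (inj₁ refl) a b
  rewrite lookup-replicate a false | lookup-replicate b false
  with lookup N a | lookup N b
... | true  | true  = neutral refl
... | true  | false = closes refl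
... | false | true  = opens refl
... | false | false = neutral refl

module Exceeds (x y dx dy : ℤ) where

  exceeds-opens : ∀ {o} → x ≡ y + + o → dx ≡ dy + + 1 → x + dx ≡ (y + dy) + + suc o
  exceeds-opens {o} refl refl = identity y dy (+ o)
    where
    identity : ∀ y dy o → (y + o) + (dy + + 1) ≡ (y + dy) + (+ 1 + o)
    identity = solve-∀

  exceeds-closes : ∀ {o} → x ≡ y + + suc o → dy ≡ dx + + 1 → x + dx ≡ (y + dy) + + o
  exceeds-closes {o} refl refl = identity y dx (+ o)
    where
    identity : ∀ y dx o → (y + (+ 1 + o)) + dx ≡ (y + (dx + + 1)) + o
    identity = solve-∀

  exceeds-neutral : ∀ {o} → x ≡ y + + o → dx ≡ dy → x + dx ≡ (y + dy) + + o
  exceeds-neutral {o} refl refl = identity y dx (+ o)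
    where
    identity : ∀ y dx o → (y + o) + dx ≡ (y + dx) + o
    identity = solve-∀

  closes-at-equality : x ≡ y + + 0 → dy ≡ dx + + 1 → x + dx ℤ.< y + dy
  closes-at-equality refl refl = ℤ.suc[i]≤j⇒i<j (ℤ.≤-reflexive (identity y dx))
    where
    identity : ∀ y dx → + 1 + ((y + + 0) + dx) ≡ y + (dx + + 1)
    identity = solve-∀

exceeds⇒≥ : ∀ {x y : ℤ} {o} → x ≡ y + + o → y ℤ.≤ x
exceeds⇒≥ {y = y} {o} refl = ℤ.i≤i+j y (+ o)

NoUnmatchedClose : ℕ → List Bracket → Set
NoUnmatchedClose o       []          = ⊤
NoUnmatchedClose o       (opn ∷ bs)  = NoUnmatchedClose (suc o) bs
NoUnmatchedClose zero    (cls ∷ bs)  = ⊥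
NoUnmatchedClose (suc o) (cls ∷ bs)  = NoUnmatchedClose o bs
NoUnmatchedClose o       (none ∷ bs) = NoUnmatchedClose o bs

rowsOrdered⇔noUnmatchedClose : {a b : Fin r} (w : Word r) → All InA w →
  ∀ {v o} → v a ≡ v b + + o →
  AlongWord (RowsOrdered a b) v w ⇔ NoUnmatchedClose o (List.map (bracket a b) w)
rowsOrdered⇔noUnmatchedClose []      _          v≡ = mk⇔ (const tt) (const (exceeds⇒≥ v≡))
rowsOrdered⇔noUnmatchedClose {a = a} {b} (x ∷ w) (x∈A ∷ w∈A) {v} {o} v≡ =
  byBracket (bracket a b x) (bracket-effect x x∈A a b) o v≡
  where
  open Equivalence
  open Exceeds (v a) (v b) (eS x a) (eS x b)
  recurse : ∀ {o} → (v ⊕ x) a ≡ (v ⊕ x) b + + o →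
    AlongWord (RowsOrdered a b) (v ⊕ x) w ⇔ NoUnmatchedClose o (List.map (bracket a b) w)
  recurse = rowsOrdered⇔noUnmatchedClose w w∈A

  extend : ∀ {o} {B : Set} → v a ≡ v b + + o →
    AlongWord (RowsOrdered a b) (v ⊕ x) w ⇔ B → AlongWord (RowsOrdered a b) v (x ∷ w) ⇔ B
  extend v≡ ih = mk⇔ (to ih ∘ proj₂) (λ g → exceeds⇒≥ v≡ , from ih g)

  byBracket : ∀ β → BracketEffect (eS x a) (eS x b) β → ∀ o → v a ≡ v b + + o →
    AlongWord (RowsOrdered a b) v (x ∷ w) ⇔ NoUnmatchedClose o (β ∷ List.map (bracket a b) w)
  byBracket opn  (opens e)   o       v≡ = extend v≡ (recurse (exceeds-opens v≡ e))
  byBracket cls  (closes e)  (suc o) v≡ = extend v≡ (recurse (exceeds-closes v≡ e))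
  byBracket none (neutral e) o       v≡ = extend v≡ (recurse (exceeds-neutral v≡ e))
  byBracket cls  (closes e)  zero    v≡ = mk⇔
    (λ (_ , ordered) → ℤ.<⇒≱ (closes-at-equality v≡ e) (AlongWord-head w ordered))
    (λ ())

rightmostUnmatched-just≢nothing : ∀ pos o k bs →
  rightmostUnmatched pos o (just k) bs ≢ nothing
rightmostUnmatched-just≢nothing pos o       k (opn ∷ bs)  = rightmostUnmatched-just≢nothing _ _ _ bs
rightmostUnmatched-just≢nothing pos zero    k (cls ∷ bs)  = rightmostUnmatched-just≢nothing _ _ _ bs
rightmostUnmatched-just≢nothing pos (suc o) k (cls ∷ bs)  = rightmostUnmatched-just≢nothing _ _ _ bs
rightmostUnmatched-just≢nothing pos o       k (none ∷ bs) = rightmostUnmatched-just≢nothing _ _ _ bs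

rightmostUnmatched≡nothing⇔ : ∀ pos o bs →
  rightmostUnmatched pos o nothing bs ≡ nothing ⇔ NoUnmatchedClose o bs
rightmostUnmatched≡nothing⇔ pos o       []          = mk⇔ (const tt) (const refl)
rightmostUnmatched≡nothing⇔ pos o       (opn ∷ bs)  = rightmostUnmatched≡nothing⇔ _ _ bs
rightmostUnmatched≡nothing⇔ pos zero    (cls ∷ bs)  =
  mk⇔ (rightmostUnmatched-just≢nothing _ _ _ bs) (λ ())
rightmostUnmatched≡nothing⇔ pos (suc o) (cls ∷ bs)  = rightmostUnmatched≡nothing⇔ _ _ bs
rightmostUnmatched≡nothing⇔ pos o       (none ∷ bs) = rightmostUnmatched≡nothing⇔ _ _ bs

crystalE≡nothing⇔ : (a b : Fin r) (w : Word r) →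
  crystalE a b w ≡ nothing ⇔ rightmostUnmatched 0 0 nothing (List.map (bracket a b) w) ≡ nothing
crystalE≡nothing⇔ a b w with rightmostUnmatched 0 0 nothing (List.map (bracket a b) w)
... | nothing = mk⇔ (const refl) (const refl)
... | just _  = mk⇔ (λ ()) (λ ())

0ˢ : Shape r
0ˢ _ = + 0

highestWeight⇔weaklyDecreasingAlong : (w : Word r) → All InA w →
  HighestWeight w ⇔ AlongWord WeaklyDecreasing 0ˢ w
highestWeight⇔weaklyDecreasingAlong w w∈A = mk⇔
  (λ hw → AlongWord-map adjacent⇒weaklyDecreasing w (AlongWord-∀ w λ ((a , b) , a~b) →
    from (rowsOrdered⇔ a b) (to (noClose⇔ a b) (hw a b a~b))))
  (λ w↓ a b a~b → from (noClose⇔ a b) (to (rowsOrdered⇔ a b)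
    (AlongWord-map (λ v↓ → weaklyDecreasing⇒adjacent v↓ ((a , b) , a~b)) w w↓)))
  where
  open Equivalence

  noClose⇔ : ∀ a b →
    crystalE a b w ≡ nothing ⇔ NoUnmatchedClose 0 (List.map (bracket a b) w)
  noClose⇔ a b =
    rightmostUnmatched≡nothing⇔ 0 0 (List.map (bracket a b) w) Fn.⇔-∘ crystalE≡nothing⇔ a b w

  rowsOrdered⇔ : ∀ a b →
    AlongWord (RowsOrdered a b) 0ˢ w ⇔ NoUnmatchedClose 0 (List.map (bracket a b) w)
  rowsOrdered⇔ a b = rowsOrdered⇔noUnmatchedClose w w∈A refl

letterOfType⇒InA : ∀ c (x : Letter r) → LetterOfType c x → InA x
letterOfType⇒InA (+ _)      _ (N≡⊥ , _) = inj₂ N≡⊥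
letterOfType⇒InA ℤ.-[1+ _ ] _ (P≡⊥ , _) = inj₁ P≡⊥

InB⇒InA : ∀ c (w : Word r) → InB c w → All InA w
InB⇒InA []       []      _            = []
InB⇒InA (c ∷ cs) (x ∷ w) (x∈c , w∈cs) = letterOfType⇒InA c x x∈c ∷ InB⇒InA cs w w∈cs

letterOfType⇒letterType≡ : ∀ c (x : Letter r) → LetterOfType c x → letterType x ≡ c
letterOfType⇒letterType≡ {r} (+ _) (P , _) (refl , refl) rewrite SubP.∣⊥∣≡0 r =
  cong +_ (ℕ.+-identityʳ Sub.∣ P ∣)
letterOfType⇒letterType≡ {r} ℤ.-[1+ _ ] _ (refl , ∣N∣≡1+m) rewrite SubP.∣⊥∣≡0 r | ∣N∣≡1+m = refl

∣p∣≡0⇒p≡⊥ : ∀ {n} (p : Subset n) → Sub.∣ p ∣ ≡ 0 → p ≡ Sub.⊥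
∣p∣≡0⇒p≡⊥ []          _     = refl
∣p∣≡0⇒p≡⊥ (false ∷ p) ∣p∣≡0 = cong (false ∷_) (∣p∣≡0⇒p≡⊥ p ∣p∣≡0)
∣p∣≡0⇒p≡⊥ (true ∷ _)  ()

InA⇒letterOfType : (x : Letter r) → InA x → LetterOfType (letterType x) x
InA⇒letterOfType {r} (P , _) (inj₂ refl) rewrite SubP.∣⊥∣≡0 r =
  refl , sym (ℕ.+-identityʳ Sub.∣ P ∣)
InA⇒letterOfType {r} (_ , N) (inj₁ refl) rewrite SubP.∣⊥∣≡0 r = negative N refl
  where
  -- −0 is +0, so the empty negative letter has to be recognised as a positive one.
  negative : (N : Subset r) → ∀ {m} → Sub.∣ N ∣ ≡ m → LetterOfType (+ 0 ℤ.- + m) (Sub.⊥ , N)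
  negative N {zero}  ∣N∣≡0   = ∣p∣≡0⇒p≡⊥ N ∣N∣≡0 , SubP.∣⊥∣≡0 r
  negative N {suc m} ∣N∣≡1+m = refl , ∣N∣≡1+m

InB-tabulate : ∀ n (f : Fin n → Letter r) → (∀ k → InA (f k)) →
  InB (List.tabulate (letterType ∘ f)) (List.tabulate f)
InB-tabulate zero    f f∈A = tt
InB-tabulate (suc n) f f∈A =
  InA⇒letterOfType (f Fin.zero) (f∈A Fin.zero) , InB-tabulate n (f ∘ Fin.suc) (f∈A ∘ Fin.suc)

record TableauFrom (v : Shape r) (n : ℕ) : Set where
  field
    shape   : Fin (suc n) → Shape r
    letter  : Fin n → Letter r
    start   : ∀ j → shape Fin.zero j ≡ v j
    letterA : ∀ k → InA (letter k)
    step    : ∀ k j → shape (Fin.suc k) j ≡ shape (Fin.inject₁ k) j + eS (letter k) j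
    decr    : ∀ k → WeaklyDecreasing (shape k)

latticeWordFrom : ∀ {v : Shape r} {n} → TableauFrom v n → Word r
latticeWordFrom T = List.tabulate (TableauFrom.letter T)

tableauTypeFrom : ∀ {v : Shape r} {n} → TableauFrom v n → List ℤ
tableauTypeFrom T = List.tabulate (letterType ∘ TableauFrom.letter T)

fromTableau : ∀ {n} → FluctuatingTableau r n → TableauFrom 0ˢ n
fromTableau T = record
  { shape = shape T ; letter = letter T ; start = start T
  ; letterA = letterA T ; step = step T ; decr = decr T }

toTableau : ∀ {n} → TableauFrom 0ˢ n → FluctuatingTableau r n
toTableau T = record
  { shape = T.shape ; letter = T.letter ; start = T.start
  ; letterA = T.letterA ; step = T.step ; decr = T.decr }
  where module T = TableauFrom T

module _ {v : Shape r} where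

  tableau-nil : WeaklyDecreasing v → TableauFrom v 0
  tableau-nil v↓ = record
    { shape = const v ; letter = λ () ; start = λ _ → refl
    ; letterA = λ () ; step = λ () ; decr = const v↓ }

  tableau-cons : ∀ {n x} → WeaklyDecreasing v → InA x →
    TableauFrom (v ⊕ x) n → TableauFrom v (suc n)
  tableau-cons {x = x} v↓ x∈A T = record
    { shape = shape′ ; letter = letter′ ; start = λ _ → refl
    ; letterA = letterA′ ; step = step′ ; decr = decr′ }
    where
    module T = TableauFrom T
    shape′ : Fin _ → Shape _
    shape′ Fin.zero    = v
    shape′ (Fin.suc k) = T.shape k
    letter′ : Fin _ → Letter _
    letter′ Fin.zero    = x
    letter′ (Fin.suc k) = T.letter k
    letterA′ : ∀ k → InA (letter′ k)
    letterA′ Fin.zero    = x∈A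
    letterA′ (Fin.suc k) = T.letterA k
    step′ : ∀ k j → shape′ (Fin.suc k) j ≡ shape′ (Fin.inject₁ k) j + eS (letter′ k) j
    step′ Fin.zero    = T.start
    step′ (Fin.suc k) = T.step k
    decr′ : ∀ k → WeaklyDecreasing (shape′ k)
    decr′ Fin.zero    = v↓
    decr′ (Fin.suc k) = T.decr k

  tableau-tail : ∀ {n} (T : TableauFrom v (suc n)) →
    TableauFrom (v ⊕ TableauFrom.letter T Fin.zero) n
  tableau-tail T = record
    { shape = T.shape ∘ Fin.suc ; letter = T.letter ∘ Fin.suc
    ; start = λ j → trans (T.step Fin.zero j) (cong (_+ eS (T.letter Fin.zero) j) (T.start j))
    ; letterA = T.letterA ∘ Fin.suc ; step = T.step ∘ Fin.suc ; decr = T.decr ∘ Fin.suc }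
    where module T = TableauFrom T

weaklyDecreasing-resp : {u v : Shape r} → (∀ j → u j ≡ v j) →
  WeaklyDecreasing u → WeaklyDecreasing v
weaklyDecreasing-resp u≗v u↓ a b a≤b = subst₂ ℤ._≤_ (u≗v b) (u≗v a) (u↓ a b a≤b)

tableau⇒weaklyDecreasingAlong : ∀ {v : Shape r} n (T : TableauFrom v n) →
  AlongWord WeaklyDecreasing v (latticeWordFrom T)
tableau⇒weaklyDecreasingAlong zero    T = weaklyDecreasing-resp T.start (T.decr Fin.zero)
  where module T = TableauFrom T
tableau⇒weaklyDecreasingAlong (suc n) T =
  weaklyDecreasing-resp T.start (T.decr Fin.zero) ,
  tableau⇒weaklyDecreasingAlong n (tableau-tail T)
  where module T = TableauFrom T

weaklyDecreasingAlong⇒tableau : ∀ c (w : Word r) {v} →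
  InB c w → AlongWord WeaklyDecreasing v w →
  Σ (TableauFrom v (length c)) λ T → tableauTypeFrom T ≡ c × latticeWordFrom T ≡ w
weaklyDecreasingAlong⇒tableau [] [] _ v↓ = tableau-nil v↓ , refl , refl
weaklyDecreasingAlong⇒tableau (c ∷ cs) (x ∷ w) (x∈c , w∈cs) (v↓ , w↓)
  with weaklyDecreasingAlong⇒tableau cs w w∈cs w↓
... | T , type≡ , word≡ =
  tableau-cons v↓ (letterOfType⇒InA c x x∈c) T ,
  cong₂ _∷_ (letterOfType⇒letterType≡ c x x∈c) type≡ , cong (x ∷_) word≡

highestWeight⇒tableau : ∀ c (w : Word r) → InB c w → HighestWeight w →
  ∃ λ (T : FluctuatingTableau r (length c)) → tableauType T ≡ c × latticeWord T ≡ w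
highestWeight⇒tableau c w w∈c hw
  with weaklyDecreasingAlong⇒tableau c w w∈c
         (Equivalence.to (highestWeight⇔weaklyDecreasingAlong w (InB⇒InA c w w∈c)) hw)
... | T , type≡ , word≡ = toTableau T , type≡ , word≡

tableau⇒highestWeight : ∀ {n} (T : FluctuatingTableau r n) →
  InB (tableauType T) (latticeWord T) × HighestWeight (latticeWord T)
tableau⇒highestWeight {n = n} T =
  w∈c ,
  Equivalence.from (highestWeight⇔weaklyDecreasingAlong (latticeWord T) (InB⇒InA _ _ w∈c))
    (tableau⇒weaklyDecreasingAlong n (fromTableau T))
  where
  w∈c : InB (tableauType T) (latticeWord T)
  w∈c = InB-tabulate n (letter T) (letterA T)

proposition8p14 : (r : ℕ) (c : List ℤ) → All (λ x → ∣ x ∣ ≤ r) c → (w : Word r) →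
    (InB c w × HighestWeight w) ⇔
      (∃ λ (T : FluctuatingTableau r (length c)) → tableauType T ≡ c × latticeWord T ≡ w)
proposition8p14 r c _ w = mk⇔
  (λ (w∈c , hw) → highestWeight⇒tableau c w w∈c hw)
  (λ (T , type≡ , word≡) →
    subst₂ (λ c w → InB c w × HighestWeight w) type≡ word≡ (tableau⇒highestWeight T))
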